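{- Let $\pi$ be a $\neg e$-normal net and let $e_0$ be an experiment of $\pi$ such that $s'(e_0) = \min\{ s'(e) : e \text{ is an experiment of } \pi\}$. Then $\mathrm{card}(\mathcal{W}(e_0))$ is the number of cut-links of $\pi$.
   Context: Nets are untyped multiplicative-exponential linear logic proof-nets built from links $ax$, $cut$, $\otimes$, ⅋ (par), $1$, $\bot$, $!$-links with boxes, $\flat$-links and $?$-links with $n\geq0$ premises. A cut is erasing when it is between a $!$-link and a $?$-link with no premise; a net is $\neg e$-normal when it contains only erasing cuts. With $D$ built from $D_0=\{+,-\}\times(A\cup\{\ast\})$ by $D_{n+1}=D_0\cup(\{+,-\}\times D_n\times D_n)\cup(\{+,-\}\times\mathcal{M}_{\mathrm{fin}}(D_n))$ and $x^\perp$ flipping polarities, an experiment $e$ of $\pi$ assigns to each $!$-link at depth $0$ a non-empty multiset of experiments of its box and to each edge at depth $0$ an element of $D$ such that: axiom conclusions and cut premises get $x,x^\perp$; $1\mapsto(+,\ast)$, $\bot\mapsto(-,\ast)$; $\otimes$ (resp. ⅋) $\mapsto(+,e(a),e(b))$ (resp. $(-,e(a),e(b))$); $\flat\mapsto(-,[e(a)])$; $?$-link with $n\geq1$ premises valued $(-,\mu_i)\mapsto(-,\sum\mu_i)$; $?$-link without premise $\mapsto(-,a)$, $a\in\mathcal{M}_{\mathrm{fin}}(D)$ arbitrary; $!$-link $o$ with $e(o)=[e_1,\dots,e_k]$: main conclusion $\mapsto(+,[e_i(c^o)]_i)$, auxiliary conclusions $\mapsto(-,\sum\mu_i)$. $\mathcal{W}(e)$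 is the sum over all depths of the multisets $a$ at premise-less $?$-links. $s(e)=(\text{number of logical edges of the depth- }0\text{ part of }\pi)+\sum_o\sum_{e^o\in e(o)}s(e^o)$, $s'(e)=s(e)+2\,\mathrm{card}(\mathcal{W}(e))$, with $\mathrm{card}$ the cardinality of a multiset. -}

module Defs where

open import Data.Nat using (ℕ; zero; suc; _+_; _*_; _≤_)
open import Data.Fin using (Fin)
open import Data.Fin.Properties using () renaming (_≟_ to _≟ᶠ_)
open import Data.List using (List; []; _∷_; [_]; _++_; map; concat; concatMap; length; filter; allFin)
open import Data.List.NonEmpty using (List⁺; _∷_; toList)
open import Data.List.Relation.Unary.All using (All; []; _∷_)
open import Data.List.Relation.Unary.Any using (Any)
open import Data.List.Relation.Binary.Pointwise using (Pointwise)
open import Data.List.Relation.Binary.Permutation.Propositional using (_↭_)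
open import Data.List.Membership.Propositional using (_∈_)
import Data.List.Membership.DecPropositional as DecMem
open import Data.Product using (_×_; Σ; ∃; _,_; proj₁; proj₂)
open import Data.Sum using (_⊎_)
open import Data.Unit using (⊤)
open import Relation.Nullary using (¬?)
open import Relation.Binary.PropositionalEquality using (_≡_)

data Pol : Set where
  pos neg : Pol

flipPol : Pol → Pol
flipPol pos = neg
flipPol neg = pos

-- D = ⋃ D_n : finite trees.  Finite multisets are represented by lists,
-- considered up to permutation via the equivalence _≈_ below.
data D (A : Set) : Set where
  atom : Pol → A → D A
  star : Pol → D A
  pair : Pol → D A → D A → D A
  bag  : Pol → List (D A) → D A

mutual
  dual : {A : Set} → D A → D A
  dual (atom p a)   = atom (flipPol p) a
  dual (star p)     = star (flipPol p)
  dual (pair p x y) = pair (flipPol p) (dual x) (dual y)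
  dual (bag p xs)   = bag (flipPol p) (dualL xs)

  dualL : {A : Set} → List (D A) → List (D A)
  dualL []       = []
  dualL (x ∷ xs) = dual x ∷ dualL xs

data _≈_ {A : Set} : D A → D A → Set where
  atom≈ : ∀ {p a} → atom p a ≈ atom p a
  star≈ : ∀ {p} → star p ≈ star p
  pair≈ : ∀ {p x x′ y y′} → x ≈ x′ → y ≈ y′ → pair p x y ≈ pair p x′ y′
  bag≈  : ∀ {p xs ys zs} → Pointwise _≈_ xs ys → ys ↭ zs → bag p xs ≈ bag p zs

-- Untyped MELL nets.  A net has edges Fin nE at depth 0, a list of
-- non-box links at depth 0, and a list of !-links (each with its box).

data Link (n : ℕ) : Set where
  ax     : (c₁ c₂ : Fin n) → Link n
  cut    : (p₁ p₂ : Fin n) → Link n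
  tensor : (a b c : Fin n) → Link n          -- premises a b, conclusion c
  par    : (a b c : Fin n) → Link n
  one    : (c : Fin n) → Link n
  bot    : (c : Fin n) → Link n
  flat   : (a c : Fin n) → Link n
  why    : (ps : List (Fin n)) (c : Fin n) → Link n   -- ?-link, n ≥ 0 premises

mutual
  record Net : Set where
    inductive
    field
      nE    : ℕ
      links : List (Link nE)
      bangs : List (Bang nE)

  -- a !-link at depth 0 together with its box
  record Bang (n : ℕ) : Set where
    inductive
    field
      box   : Net
      main  : Fin (Net.nE box)
      aux   : List (Fin (Net.nE box) × Fin n) -- (aux. concl. of box , aux. concl. of the !-link)
      concl : Fin n

open Net public
open Bang public

premisesL : ∀ {n} → Link n → List (Fin n)
premisesL (ax _ _)       = []
premisesL (cut p₁ p₂)    = p₁ ∷ p₂ ∷ []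
premisesL (tensor a b _) = a ∷ b ∷ []
premisesL (par a b _)    = a ∷ b ∷ []
premisesL (one _)        = []
premisesL (bot _)        = []
premisesL (flat a _)     = [ a ]
premisesL (why ps _)     = ps

conclusionsL : ∀ {n} → Link n → List (Fin n)
conclusionsL (ax c₁ c₂)     = c₁ ∷ c₂ ∷ []
conclusionsL (cut _ _)      = []
conclusionsL (tensor _ _ c) = [ c ]
conclusionsL (par _ _ c)    = [ c ]
conclusionsL (one c)        = [ c ]
conclusionsL (bot c)        = [ c ]
conclusionsL (flat _ c)     = [ c ]
conclusionsL (why _ c)      = [ c ]

conclusionsB : ∀ {n} → Bang n → List (Fin n)
conclusionsB b = concl b ∷ map proj₂ (aux b)

premisesN : (π : Net) → List (Fin (nE π))
premisesN π = concatMap premisesL (links π)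

conclusionsN : (π : Net) → List (Fin (nE π))
conclusionsN π = concatMap conclusionsL (links π) ++ concatMap conclusionsB (bangs π)

occ : ∀ {n} → Fin n → List (Fin n) → ℕ
occ x xs = length (filter (x ≟ᶠ_) xs)

-- Well-formed (proof-structure) nets: every edge is the conclusion of exactly
-- one link and the premise of at most one link; boxes are well-formed nets
-- whose conclusions (edges premise of no link) are exactly the main
-- conclusion c^o and the auxiliary conclusions listed in the !-link.
mutual
  WF : Net → Set
  WF π = (∀ x → occ x (conclusionsN π) ≡ 1)
       × (∀ x → occ x (premisesN π) ≤ 1)
       × WFBangs (bangs π)

  WFBangs : ∀ {n} → List (Bang n) → Set
  WFBangs []       = ⊤
  WFBangs (b ∷ bs) = WFBang b × WFBangs bs

  WFBang : ∀ {n} → Bang n → Set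
  WFBang b = WF (box b)
           × (∀ y → (occ y (premisesN (box b)) ≡ 0 → occ y (main b ∷ map proj₁ (aux b)) ≡ 1)
                  × (occ y (premisesN (box b)) ≡ 1 → occ y (main b ∷ map proj₁ (aux b)) ≡ 0))

ErasingCut : (π : Net) → Fin (nE π) → Fin (nE π) → Set
ErasingCut π p₁ p₂ =
    (Any (λ b → concl b ≡ p₁) (bangs π) × why [] p₂ ∈ links π)
  ⊎ (Any (λ b → concl b ≡ p₂) (bangs π) × why [] p₁ ∈ links π)

IsErasing : (π : Net) → Link (nE π) → Set
IsErasing π (cut p₁ p₂) = ErasingCut π p₁ p₂
IsErasing π _           = ⊤

mutual
  NotENormal : Net → Set
  NotENormal π = All (IsErasing π) (links π) × NotENormalBangs (bangs π)

  NotENormalBangs : ∀ {n} → List (Bang n) → Set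
  NotENormalBangs []       = ⊤
  NotENormalBangs (b ∷ bs) = NotENormal (box b) × NotENormalBangs bs

isCut : ∀ {n} → Link n → ℕ
isCut (cut _ _) = 1
isCut _         = 0

mutual
  ncuts : Net → ℕ
  ncuts π = cutsL (links π) + ncutsBangs (bangs π)

  cutsL : ∀ {n} → List (Link n) → ℕ
  cutsL []       = 0
  cutsL (l ∷ ls) = isCut l + cutsL ls

  ncutsBangs : ∀ {n} → List (Bang n) → ℕ
  ncutsBangs []       = 0
  ncutsBangs (b ∷ bs) = ncuts (box b) + ncutsBangs bs

mutual
  record Exp (A : Set) (π : Net) : Set where
    inductive
    field
      val   : Fin (nE π) → D A
      boxes : All (λ b → List⁺ (Exp A (box b))) (bangs π)

open Exp public

module _ {A : Set} where

  LinkOK : {n : ℕ} → (Fin n → D A) → Link n → Set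
  LinkOK v (ax c₁ c₂)     = v c₂ ≈ dual (v c₁)
  LinkOK v (cut p₁ p₂)    = v p₂ ≈ dual (v p₁)
  LinkOK v (tensor a b c) = v c ≈ pair pos (v a) (v b)
  LinkOK v (par a b c)    = v c ≈ pair neg (v a) (v b)
  LinkOK v (one c)        = v c ≈ star pos
  LinkOK v (bot c)        = v c ≈ star neg
  LinkOK v (flat a c)     = v c ≈ bag neg [ v a ]
  LinkOK v (why [] c)     = Σ (List (D A)) λ a → v c ≈ bag neg a
  LinkOK v (why (p ∷ ps) c) =
    Σ (List (List (D A))) λ μs →
      Pointwise (λ q μ → v q ≈ bag neg μ) (p ∷ ps) μs × v c ≈ bag neg (concat μs)

  mutual
    IsExp : {π : Net} → Exp A π → Set
    IsExp {π} e = All (LinkOK (val e)) (links π) × BangsOK (val e) (bangs π) (boxes e)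

    BangsOK : {n : ℕ} → (Fin n → D A) → (bs : List (Bang n))
            → All (λ b → List⁺ (Exp A (box b))) bs → Set
    BangsOK v []       []         = ⊤
    BangsOK v (b ∷ bs) (E ∷ Es)   = BangOK v b (toList E) × BangsOK v bs Es

    BangOK : {n : ℕ} → (Fin n → D A) → (b : Bang n) → List (Exp A (box b)) → Set
    BangOK v b E =
        AllExp E
      × v (concl b) ≈ bag pos (map (λ eᵢ → val eᵢ (main b)) E)
      × All (λ yz → Σ (List (List (D A))) λ μs →
               Pointwise (λ eᵢ μ → val eᵢ (proj₁ yz) ≈ bag neg μ) E μs
             × v (proj₂ yz) ≈ bag neg (concat μs))
            (aux b)

    AllExp : {π : Net} → List (Exp A π) → Set
    AllExp []       = ⊤
    AllExp (e ∷ es) = IsExp e × AllExp es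

  bagOf : D A → List (D A)
  bagOf (bag _ a) = a
  bagOf _         = []

  W0 : {n : ℕ} → (Fin n → D A) → List (Link n) → List (D A)
  W0 v []               = []
  W0 v (why [] c ∷ ls)  = bagOf (v c) ++ W0 v ls
  W0 v (_ ∷ ls)         = W0 v ls

  mutual
    W : {π : Net} → Exp A π → List (D A)
    W {π} e = W0 (val e) (links π) ++ WBangs (bangs π) (boxes e)

    WBangs : {n : ℕ} → (bs : List (Bang n)) → All (λ b → List⁺ (Exp A (box b))) bs → List (D A)
    WBangs []       []       = []
    WBangs (b ∷ bs) (E ∷ Es) = WList (toList E) ++ WBangs bs Es

    WList : {π : Net} → List (Exp A π) → List (D A)
    WList []       = []
    WList (e ∷ es) = W e ++ WList es

  card : List (D A) → ℕ
  card = length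

-- non-logical (♭-typed) edges at depth 0: conclusions of ♭-links and
-- auxiliary conclusions of !-links
flatConcl : ∀ {n} → Link n → List (Fin n)
flatConcl (flat _ c) = [ c ]
flatConcl _          = []

nonLogical : (π : Net) → List (Fin (nE π))
nonLogical π = concatMap flatConcl (links π) ++ concatMap (λ b → map proj₂ (aux b)) (bangs π)

logicalEdges : Net → ℕ
logicalEdges π = length (filter (λ x → ¬? (x ∈? nonLogical π)) (allFin (nE π)))
  where open DecMem (_≟ᶠ_ {nE π}) using (_∈?_)

module _ {A : Set} where
  mutual
    s : {π : Net} → Exp A π → ℕ
    s {π} e = logicalEdges π + sBangs (bangs π) (boxes e)

    sBangs : {n : ℕ} → (bs : List (Bang n)) → All (λ b → List⁺ (Exp A (box b))) bs → ℕ
    sBangs []       []       = 0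
    sBangs (b ∷ bs) (E ∷ Es) = sList (toList E) + sBangs bs Es

    sList : {π : Net} → List (Exp A π) → ℕ
    sList []       = 0
    sList (e ∷ es) = s e + sList es

  s′ : {π : Net} → Exp A π → ℕ
  s′ e = s e + 2 * card (W e)

module Submission where

-- The proof squeezes card (𝒲 e₀) between two bounds.
--
-- * Lower bound (cuts≤card-W): every experiment e has ncuts π ≤ card (𝒲 e).
--   Each cut is erasing: one premise is the conclusion of a !-link, valued
--   (+, [x₁ … xₖ]) with k ≥ 1, the other that of a premise-less ?-link, whose
--   bag is therefore non-empty; distinct cuts give distinct ?-links because an
--   edge is the premise of at most one link (a double-counting argument).
-- * Upper bound (thin): every experiment e₀ has a "thin" companion e with one
--   sub-experiment per box, recursively, so that s e ≤ sThin π ≤ s e₀ and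
--   card (𝒲 e) ≤ ncuts π.  Its values are recomputed from the links: a
--   premise-less ?-link gets (-, []) unless it is cut against a !-link, and then
--   the dual of that link's new singleton bag.  Nets are not assumed acyclic, so
--   the recomputation recurses on the size of the old value; chains of ?-links
--   with one non-empty premise keep the size, and are followed by a walk that
--   either reaches a top or enters a cycle (pigeonhole), where old values stay.
-- Minimality then gives s e₀ + 2·card 𝒲 e₀ ≤ s e + 2·card 𝒲 e ≤ s e₀ + 2·ncuts π.

open import Defs
open import Data.Nat using (ℕ; zero; suc; _+_; _*_; _≤_; _<_; _<?_; _∸_; z≤n; s≤s; pred)
open import Data.Nat.Properties
open import Data.Nat.Induction using (<-rec)
open import Algebra.Properties.CommutativeSemigroup +-commutativeSemigroup using (interchange; x∙yz≈y∙xz)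
open import Data.Bool using (Bool; true; false; T; not; if_then_else_)
open import Data.Fin using (Fin; toℕ)
open import Data.Fin.Properties using (pigeonhole; toℕ<n) renaming (_≟_ to _≟ᶠ_)
open import Data.List using (List; []; _∷_; [_]; _++_; map; concat; concatMap; length; filter; null)
open import Data.List.Properties using (length-++; ++-identityʳ; map-++; map-∘; map-id; ∷-injective; filter-++)
open import Data.List.NonEmpty using (List⁺; _∷_) renaming (head to head⁺)
open import Data.List.Relation.Binary.Pointwise using (Pointwise; []; _∷_; Pointwise-length)
open import Data.List.Relation.Binary.Permutation.Propositional using (_↭_; refl; prep; swap; trans)
open import Data.List.Relation.Binary.Permutation.Propositional.Properties using (↭-length)
open import Data.List.Relation.Unary.All as All using (All; []; _∷_)
open import Data.List.Relation.Unary.Any using (Any; here; there)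
open import Data.List.Membership.Propositional using (_∈_)
open import Data.List.Membership.Propositional.Properties using (∈-++⁻; ∈-++⁺ˡ; ∈-++⁺ʳ; ∈-map⁺; ∈-map⁻)
open import Data.Maybe using (Maybe; just; nothing; is-just)
open import Data.Product using (_×_; Σ; _,_; proj₁; proj₂)
open import Data.Sum using (_⊎_; inj₁; inj₂) renaming (map to ⊎-map)
open import Data.Unit using (⊤; tt)
open import Data.Empty using (⊥-elim)
open import Relation.Nullary using (yes; no)
open import Relation.Binary.PropositionalEquality as Eq using (_≡_; _≢_; refl; sym; cong; cong₂; subst; subst₂)

δ : ∀ {n} → Fin n → Fin n → ℕ
δ x y with x ≟ᶠ y
... | yes _ = 1
... | no _  = 0

-- δ is symmetric, which lets double counting swap the roles of two lists
δ-sym : ∀ {n} (x y : Fin n) → δ x y ≡ δ y x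
δ-sym x y with x ≟ᶠ y | y ≟ᶠ x
... | yes _ | yes _ = refl
... | no _  | no _  = refl
... | yes p | no q  = ⊥-elim (q (sym p))
... | no p  | yes q = ⊥-elim (p (sym q))

occ-∷ : ∀ {n} (x y : Fin n) ys → occ x (y ∷ ys) ≡ δ x y + occ x ys
occ-∷ x y ys with x ≟ᶠ y
... | yes _ = refl
... | no _  = refl

occ-++ : ∀ {n} (x : Fin n) xs ys → occ x (xs ++ ys) ≡ occ x xs + occ x ys
occ-++ x xs ys = Eq.trans (cong length (filter-++ (x ≟ᶠ_) xs ys)) (length-++ (filter (x ≟ᶠ_) xs))

∈⇒occ : ∀ {n} {x : Fin n} {xs} → x ∈ xs → 1 ≤ occ x xs
∈⇒occ {x = x} {y ∷ xs} (here refl) with x ≟ᶠ x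
... | yes _ = s≤s z≤n
... | no x≢x = ⊥-elim (x≢x refl)
∈⇒occ {x = x} {y ∷ xs} (there m) rewrite occ-∷ x y xs = ≤-trans (∈⇒occ m) (m≤n+m _ (δ x y))

occ⇒∈ : ∀ {n} {x : Fin n} xs → 1 ≤ occ x xs → x ∈ xs
occ⇒∈ {x = x} (y ∷ xs) h with x ≟ᶠ y
... | yes refl = here refl
... | no _     = there (occ⇒∈ xs h)

module _ {B : Set} where

  nonNull-false : ∀ (l : List B) → not (null l) ≡ false → l ≡ []
  nonNull-false [] _ = refl

  nonNull-true : ∀ (l : List B) → not (null l) ≡ true → 1 ≤ length l
  nonNull-true (_ ∷ _) _ = s≤s z≤n

  length≡0⇒[] : ∀ (l : List B) → length l ≡ 0 → l ≡ []
  length≡0⇒[] [] _ = refl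

sumL : ∀ {B : Set} → (B → ℕ) → List B → ℕ
sumL f []       = 0
sumL f (x ∷ xs) = f x + sumL f xs

sumL-mono : ∀ {B : Set} (f g : B → ℕ) xs → (∀ x → x ∈ xs → f x ≤ g x) → sumL f xs ≤ sumL g xs
sumL-mono f g []       h = z≤n
sumL-mono f g (x ∷ xs) h = +-mono-≤ (h x (here refl)) (sumL-mono f g xs (λ y m → h y (there m)))

sumL-cong : ∀ {B : Set} (f g : B → ℕ) xs → (∀ x → f x ≡ g x) → sumL f xs ≡ sumL g xs
sumL-cong f g []       h = refl
sumL-cong f g (x ∷ xs) h = cong₂ _+_ (h x) (sumL-cong f g xs h)

sumL-+ : ∀ {B : Set} (f g : B → ℕ) xs → sumL (λ y → f y + g y) xs ≡ sumL f xs + sumL g xs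
sumL-+ f g []       = refl
sumL-+ f g (x ∷ xs) rewrite sumL-+ f g xs = interchange (f x) (g x) (sumL f xs) (sumL g xs)

sumL-const1 : ∀ {B : Set} (xs : List B) → sumL (λ _ → 1) xs ≡ length xs
sumL-const1 []       = refl
sumL-const1 (x ∷ xs) = cong suc (sumL-const1 xs)

sumL-δ : ∀ {n} (x : Fin n) ys → sumL (λ y → δ y x) ys ≡ occ x ys
sumL-δ x []       = refl
sumL-δ x (y ∷ ys) rewrite occ-∷ x y ys | δ-sym y x = cong (δ x y +_) (sumL-δ x ys)

double-count : ∀ {n} (xs ys : List (Fin n)) → sumL (λ x → occ x ys) xs ≡ sumL (λ y → occ y xs) ys
double-count []       ys = sym (no-occurrences ys)
  where
  no-occurrences : ∀ {n} (ys : List (Fin n)) → sumL (λ y → occ y []) ys ≡ 0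
  no-occurrences []       = refl
  no-occurrences (y ∷ ys) = no-occurrences ys
double-count (x ∷ xs) ys = begin
  occ x ys + sumL (λ x → occ x ys) xs         ≡⟨ cong (occ x ys +_) (double-count xs ys) ⟩
  occ x ys + sumL (λ y → occ y xs) ys         ≡⟨ cong (_+ sumL (λ y → occ y xs) ys) (sym (sumL-δ x ys)) ⟩
  sumL (λ y → δ y x) ys + sumL (λ y → occ y xs) ys ≡⟨ sym (sumL-+ (λ y → δ y x) (λ y → occ y xs) ys) ⟩
  sumL (λ y → δ y x + occ y xs) ys             ≡⟨ sumL-cong _ _ ys (λ y → sym (occ-∷ y x xs)) ⟩
  sumL (λ y → occ y (x ∷ xs)) ys               ∎
  where open Eq.≡-Reasoning

-- For a partial map up : Fin N → Maybe (Fin N),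
-- top k x follows up from x for at most k steps and returns the first point
-- where up is undefined, or nothing if the fuel runs out.  With fuel N the
-- answer is final: a walk that survives N steps revisits a point, hence cycles.

module PointerChase {N : ℕ} (up : Fin N → Maybe (Fin N)) where

  mutual
    top : ℕ → Fin N → Maybe (Fin N)
    top zero    x = nothing
    top (suc k) x = top-from k x (up x)

    top-from : ℕ → Fin N → Maybe (Fin N) → Maybe (Fin N)
    top-from k x nothing  = just x
    top-from k x (just p) = top k p

  step : Fin N → Maybe (Fin N) → Fin N
  step x nothing  = x
  step x (just p) = p

  walk : ℕ → Fin N → Fin N
  walk zero    x = x
  walk (suc i) x = walk i (step x (up x))

  Moves : Fin N → Set
  Moves x = T (is-just (up x))

  walk-+ : ∀ i j x → walk (i + j) x ≡ walk j (walk i x)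
  walk-+ zero    j x = refl
  walk-+ (suc i) j x = walk-+ i j (step x (up x))

  top-mono : ∀ k x t → top k x ≡ just t → top (suc k) x ≡ just t
  top-mono (suc k) x t e with up x
  ... | nothing = e
  ... | just p  = top-mono k p t e

  out-of-fuel⇒moves : ∀ k x → top k x ≡ nothing → ∀ i → i < k → Moves (walk i x)
  out-of-fuel⇒moves (suc k) x e i i<k with up x in eq
  out-of-fuel⇒moves (suc k) x () i       i<k       | nothing
  out-of-fuel⇒moves (suc k) x e  zero    i<k       | just p rewrite eq = tt
  out-of-fuel⇒moves (suc k) x e  (suc i) (s≤s i<k) | just p rewrite eq = out-of-fuel⇒moves k p e i i<k

  moves⇒out-of-fuel : ∀ k x → (∀ i → i < k → Moves (walk i x)) → top k x ≡ nothing
  moves⇒out-of-fuel zero    x h = refl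
  moves⇒out-of-fuel (suc k) x h with up x in eq | h 0 (s≤s z≤n)
  ... | just p | _ = moves⇒out-of-fuel k p
                       (λ i i<k → subst (λ z → Moves (walk i z)) (cong (step x) eq) (h (suc i) (s≤s i<k)))

  -- a walk moving for N steps moves forever: by pigeonhole two of the points
  -- walk 0 x … walk N x coincide, so the walk is eventually periodic
  moves-forever : ∀ x → (∀ i → i < N → Moves (walk i x)) → ∀ i → Moves (walk i x)
  moves-forever x moving with pigeonhole ≤-refl (λ (i : Fin (suc N)) → walk (toℕ i) x)
  ... | i₀ , j₀ , a<b , same = <-rec (λ i → Moves (walk i x)) moves-at
    where
    a b : ℕ
    a = toℕ i₀
    b = toℕ j₀
    b≤N : b ≤ N
    b≤N = ≤-pred (toℕ<n j₀)
    moves-at : ∀ i → (∀ {j} → j < i → Moves (walk j x)) → Moves (walk i x)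
    moves-at i ih with i <? N
    ... | yes i<N = moving i i<N
    ... | no i≮N = subst Moves periodic (ih (subst (a + t <_) b+t≡i (+-monoˡ-< t a<b)))
      where
      t : ℕ
      t = i ∸ b
      b+t≡i : b + t ≡ i
      b+t≡i = m+[n∸m]≡n (≤-trans b≤N (≮⇒≥ i≮N))
      periodic : walk (a + t) x ≡ walk i x
      periodic = begin
        walk (a + t) x   ≡⟨ walk-+ a t x ⟩
        walk t (walk a x) ≡⟨ cong (walk t) same ⟩
        walk t (walk b x) ≡⟨ sym (walk-+ b t x) ⟩
        walk (b + t) x   ≡⟨ cong (λ z → walk z x) b+t≡i ⟩
        walk i x         ∎
        where open Eq.≡-Reasoning

  top-stable : ∀ k x → N ≤ k → top (suc k) x ≡ top k x
  top-stable k x N≤k with top k x in eq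
  ... | just t  = top-mono k x t eq
  ... | nothing = moves⇒out-of-fuel (suc k) x
                    (λ i _ → moves-forever x (λ j j<N → out-of-fuel⇒moves k x eq j (<-≤-trans j<N N≤k)) i)

top-here : ∀ {N} (up : Fin N → Maybe (Fin N)) x → up x ≡ nothing → PointerChase.top up N x ≡ just x
top-here {suc N} up x e with up x
... | nothing = refl
top-here {suc N} up x () | just _

top-successor : ∀ {N} (up : Fin N → Maybe (Fin N)) x p → up x ≡ just p
              → PointerChase.top up N p ≡ PointerChase.top up N x
top-successor {suc N} up x p e = Eq.trans (sym (one-step e)) (top-stable (suc N) x ≤-refl)
  where
  open PointerChase up
  one-step : up x ≡ just p → top (suc (suc N)) x ≡ top (suc N) p
  one-step e with up x
  one-step refl | just .p = refl

module _ {n : ℕ} {B : Set} where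

  lookupT : Fin n → List (Fin n × B) → Maybe B
  lookupT x []            = nothing
  lookupT x ((k , v) ∷ t) with x ≟ᶠ k
  ... | yes _ = just v
  ... | no _  = lookupT x t

  keys : List (Fin n × B) → List (Fin n)
  keys = map proj₁

  lookupT-∈ : ∀ {x : Fin n} {v : B} {t} → (x , v) ∈ t → occ x (keys t) ≤ 1 → lookupT x t ≡ just v
  lookupT-∈ {x} {t = (k , w) ∷ t} (here refl) u with x ≟ᶠ x
  ... | yes _  = refl
  ... | no x≢x = ⊥-elim (x≢x refl)
  lookupT-∈ {x} {t = (k , w) ∷ t} (there m) u with x ≟ᶠ k
  ... | yes refl = ⊥-elim (1+n≰n (≤-trans (s≤s (∈⇒occ (∈-map⁺ proj₁ m))) u))
  ... | no _     = lookupT-∈ m u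

  lookupT-sound : ∀ {x : Fin n} {v : B} t → lookupT x t ≡ just v → (x , v) ∈ t
  lookupT-sound {x} ((k , w) ∷ t) e with x ≟ᶠ k
  lookupT-sound {x} ((k , w) ∷ t) refl | yes refl = here refl
  ... | no _ = there (lookupT-sound t e)

-- Size and shape of elements of D.  The size of a value counts its nodes and is
-- invariant under ≈; it is the fuel of the recomputation of values below.

module _ {A : Set} where

  mutual
    size : D A → ℕ
    size (atom p a)   = 1
    size (star p)     = 1
    size (pair p x y) = suc (size x + size y)
    size (bag p l)    = suc (sizes l)

    sizes : List (D A) → ℕ
    sizes []       = 0
    sizes (x ∷ xs) = size x + sizes xs

  size-suc : ∀ (d : D A) → suc (pred (size d)) ≡ size d
  size-suc (atom _ _)   = refl
  size-suc (star _)     = refl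
  size-suc (pair _ _ _) = refl
  size-suc (bag _ _)    = refl

  size-pos : ∀ d → 1 ≤ size d
  size-pos d = subst (1 ≤_) (size-suc d) (s≤s z≤n)

  sizes-++ : ∀ xs ys → sizes (xs ++ ys) ≡ sizes xs + sizes ys
  sizes-++ []       ys = refl
  sizes-++ (x ∷ xs) ys rewrite sizes-++ xs ys = sym (+-assoc (size x) _ _)

  sizes-↭ : ∀ {xs ys} → xs ↭ ys → sizes xs ≡ sizes ys
  sizes-↭ refl         = refl
  sizes-↭ (prep x p)   = cong (size x +_) (sizes-↭ p)
  sizes-↭ (swap x y p) = Eq.trans (cong (λ t → size x + (size y + t)) (sizes-↭ p)) (x∙yz≈y∙xz (size x) (size y) _)
  sizes-↭ (trans p q)  = Eq.trans (sizes-↭ p) (sizes-↭ q)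

  mutual
    size-≈ : ∀ {x y : D A} → x ≈ y → size x ≡ size y
    size-≈ atom≈        = refl
    size-≈ star≈        = refl
    size-≈ (pair≈ p q)  = cong suc (cong₂ _+_ (size-≈ p) (size-≈ q))
    size-≈ (bag≈ pw pm) = cong suc (Eq.trans (sizes-pw pw) (sizes-↭ pm))

    sizes-pw : ∀ {xs ys : List (D A)} → Pointwise _≈_ xs ys → sizes xs ≡ sizes ys
    sizes-pw []       = refl
    sizes-pw (r ∷ rs) = cong₂ _+_ (size-≈ r) (sizes-pw rs)

  mutual
    ≈-refl : ∀ (x : D A) → x ≈ x
    ≈-refl (atom p a)   = atom≈
    ≈-refl (star p)     = star≈
    ≈-refl (pair p x y) = pair≈ (≈-refl x) (≈-refl y)
    ≈-refl (bag p l)    = bag≈ (pw-refl l) refl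

    pw-refl : ∀ (l : List (D A)) → Pointwise _≈_ l l
    pw-refl []      = []
    pw-refl (x ∷ l) = ≈-refl x ∷ pw-refl l

  ≡⇒≈ : ∀ {x y : D A} → x ≡ y → x ≈ y
  ≡⇒≈ {x} refl = ≈-refl x

  ≡-≈-trans : ∀ {x y z : D A} → x ≡ y → y ≈ z → x ≈ z
  ≡-≈-trans refl r = r

  mutual
    dual-dual : ∀ (d : D A) → dual (dual d) ≡ d
    dual-dual (atom pos a)   = refl
    dual-dual (atom neg a)   = refl
    dual-dual (star pos)     = refl
    dual-dual (star neg)     = refl
    dual-dual (pair pos x y) = cong₂ (pair pos) (dual-dual x) (dual-dual y)
    dual-dual (pair neg x y) = cong₂ (pair neg) (dual-dual x) (dual-dual y)
    dual-dual (bag pos l)    = cong (bag pos) (dualL-dualL l)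
    dual-dual (bag neg l)    = cong (bag neg) (dualL-dualL l)

    dualL-dualL : ∀ (l : List (D A)) → dualL (dualL l) ≡ l
    dualL-dualL []      = refl
    dualL-dualL (x ∷ l) = cong₂ _∷_ (dual-dual x) (dualL-dualL l)

  length-dualL : ∀ (l : List (D A)) → length (dualL l) ≡ length l
  length-dualL []      = refl
  length-dualL (x ∷ l) = cong suc (length-dualL l)

  Shape : Set
  Shape = Maybe (Pol × ℕ)

  shape : D A → Shape
  shape (bag p l) = just (p , length l)
  shape _         = nothing

  shape-≈ : ∀ {x y : D A} → x ≈ y → shape x ≡ shape y
  shape-≈ atom≈        = refl
  shape-≈ star≈        = refl
  shape-≈ (pair≈ _ _)  = refl
  shape-≈ {bag p xs} (bag≈ pw pm) = cong (λ k → just (p , k)) (Eq.trans (Pointwise-length pw) (↭-length pm))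

  shape-bag : ∀ (x : D A) {p k} → shape x ≡ just (p , k) → (x ≡ bag p (bagOf x)) × (length (bagOf x) ≡ k)
  shape-bag (bag p l) refl = refl , refl

  flipShape : Shape → Shape
  flipShape (just (p , k)) = just (flipPol p , k)
  flipShape nothing        = nothing

  flipShape-involutive : ∀ m → flipShape (flipShape m) ≡ m
  flipShape-involutive nothing          = refl
  flipShape-involutive (just (pos , k)) = refl
  flipShape-involutive (just (neg , k)) = refl

  shape-dual : ∀ (d : D A) → shape (dual d) ≡ flipShape (shape d)
  shape-dual (atom p a)   = refl
  shape-dual (star p)     = refl
  shape-dual (pair p x y) = refl
  shape-dual (bag p l)    = cong (λ k → just (flipPol p , k)) (length-dualL l)

  -- x ≼ y: whenever y is a bag, x is a bag of the same polarity and of smaller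
  -- or equal cardinality.  The thin experiment is ≼ the original one everywhere.
  ShapeBelow : Shape → Shape → Set
  ShapeBelow mx nothing        = ⊤
  ShapeBelow mx (just (p , k)) = Σ ℕ λ k′ → (mx ≡ just (p , k′)) × (k′ ≤ k)

  _≼_ : D A → D A → Set
  x ≼ y = ShapeBelow (shape x) (shape y)

  ≼-refl : ∀ (x : D A) → x ≼ x
  ≼-refl x with shape x
  ... | nothing      = tt
  ... | just (p , k) = k , refl , ≤-refl

  ≼-respʳ : ∀ {x y y′ : D A} → shape y ≡ shape y′ → x ≼ y → x ≼ y′
  ≼-respʳ {x} e r = subst (ShapeBelow (shape x)) e r

  ≼-bag : ∀ (x y : D A) {p k} → shape y ≡ just (p , k) → x ≼ y → (x ≡ bag p (bagOf x)) × (length (bagOf x) ≤ k)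
  ≼-bag x y {p} {k} e r with shape y
  ≼-bag x y {p} {k} refl (k′ , e′ , le) | .(just (p , k)) =
    let (x-bag , len) = shape-bag x e′ in x-bag , subst (_≤ k) (sym len) le

length≤Σocc : ∀ {n} (xs ys : List (Fin n)) → (∀ {x} → x ∈ xs → x ∈ ys) → length xs ≤ sumL (λ y → occ y xs) ys
length≤Σocc xs ys xs⊆ys = begin
  length xs                  ≡⟨ sym (sumL-const1 xs) ⟩
  sumL (λ _ → 1) xs          ≤⟨ sumL-mono _ _ xs (λ x m → ∈⇒occ (xs⊆ys m)) ⟩
  sumL (λ x → occ x ys) xs   ≡⟨ double-count xs ys ⟩
  sumL (λ y → occ y xs) ys   ∎
  where open ≤-Reasoning

Σocc≤length : ∀ {n} (xs ys : List (Fin n)) → (∀ x → occ x ys ≤ 1) → sumL (λ y → occ y xs) ys ≤ length xs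
Σocc≤length xs ys unique = begin
  sumL (λ y → occ y xs) ys   ≡⟨ sym (double-count xs ys) ⟩
  sumL (λ x → occ x ys) xs   ≤⟨ sumL-mono _ _ xs (λ x _ → unique x) ⟩
  sumL (λ _ → 1) xs          ≡⟨ sumL-const1 xs ⟩
  length xs                  ∎
  where open ≤-Reasoning

occ-concatMap-mono : ∀ {n} {B : Set} (f g : B → List (Fin n)) x → (∀ b → occ x (f b) ≤ occ x (g b))
                   → ∀ bs → occ x (concatMap f bs) ≤ occ x (concatMap g bs)
occ-concatMap-mono f g x h []       = z≤n
occ-concatMap-mono f g x h (b ∷ bs)
  rewrite occ-++ x (f b) (concatMap f bs) | occ-++ x (g b) (concatMap g bs) =
  +-mono-≤ (h b) (occ-concatMap-mono f g x h bs)

module _ {n : ℕ} where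

  leafOf : Link n → List (Fin n)
  leafOf (why [] c) = [ c ]
  leafOf _          = []

  leaves : List (Link n) → List (Fin n)
  leaves = concatMap leafOf

  W0-length : ∀ {A : Set} (v : Fin n → D A) ls → length (W0 v ls) ≡ sumL (λ c → length (bagOf (v c))) (leaves ls)
  W0-length v []                    = refl
  W0-length v (why [] c ∷ ls)       = Eq.trans (length-++ (bagOf (v c))) (cong (length (bagOf (v c)) +_) (W0-length v ls))
  W0-length v (why (_ ∷ _) _ ∷ ls)  = W0-length v ls
  W0-length v (ax _ _ ∷ ls)         = W0-length v ls
  W0-length v (cut _ _ ∷ ls)        = W0-length v ls
  W0-length v (tensor _ _ _ ∷ ls)   = W0-length v ls
  W0-length v (par _ _ _ ∷ ls)      = W0-length v ls
  W0-length v (one _ ∷ ls)          = W0-length v ls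
  W0-length v (bot _ ∷ ls)          = W0-length v ls
  W0-length v (flat _ _ ∷ ls)       = W0-length v ls

  ∈-leaves⁻ : ∀ ls {c} → c ∈ leaves ls → why [] c ∈ ls
  ∈-leaves⁻ (why [] c ∷ ls)      (here refl) = here refl
  ∈-leaves⁻ (why [] c ∷ ls)      (there m)   = there (∈-leaves⁻ ls m)
  ∈-leaves⁻ (why (_ ∷ _) _ ∷ ls) m = there (∈-leaves⁻ ls m)
  ∈-leaves⁻ (ax _ _ ∷ ls)        m = there (∈-leaves⁻ ls m)
  ∈-leaves⁻ (cut _ _ ∷ ls)       m = there (∈-leaves⁻ ls m)
  ∈-leaves⁻ (tensor _ _ _ ∷ ls)  m = there (∈-leaves⁻ ls m)
  ∈-leaves⁻ (par _ _ _ ∷ ls)     m = there (∈-leaves⁻ ls m)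
  ∈-leaves⁻ (one _ ∷ ls)         m = there (∈-leaves⁻ ls m)
  ∈-leaves⁻ (bot _ ∷ ls)         m = there (∈-leaves⁻ ls m)
  ∈-leaves⁻ (flat _ _ ∷ ls)      m = there (∈-leaves⁻ ls m)

  ∈-leaves⁺ : ∀ ls {c} → why [] c ∈ ls → c ∈ leaves ls
  ∈-leaves⁺ (L ∷ ls) (here refl) = here refl
  ∈-leaves⁺ (L ∷ ls) (there m)   = ∈-++⁺ʳ (leafOf L) (∈-leaves⁺ ls m)

  occ-leafOf : ∀ x (L : Link n) → occ x (leafOf L) ≤ occ x (conclusionsL L)
  occ-leafOf x (why [] c)      = ≤-refl
  occ-leafOf x (why (_ ∷ _) _) = z≤n
  occ-leafOf x (ax _ _)        = z≤n
  occ-leafOf x (cut _ _)       = z≤n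
  occ-leafOf x (tensor _ _ _)  = z≤n
  occ-leafOf x (par _ _ _)     = z≤n
  occ-leafOf x (one _)         = z≤n
  occ-leafOf x (bot _)         = z≤n
  occ-leafOf x (flat _ _)      = z≤n

-- In a well-formed net every edge is the conclusion of exactly one link, so it
-- is a leaf at most once.
leaves-unique : (π : Net) → WF π → ∀ x → occ x (leaves (links π)) ≤ 1
leaves-unique π wf x = begin
  occ x (leaves (links π))                       ≤⟨ occ-concatMap-mono leafOf conclusionsL x (occ-leafOf x) (links π) ⟩
  occ x (concatMap conclusionsL (links π))       ≤⟨ m≤m+n _ _ ⟩
  occ x (concatMap conclusionsL (links π)) + occ x (concatMap conclusionsB (bangs π))
      ≡⟨ sym (occ-++ x (concatMap conclusionsL (links π)) _) ⟩
  occ x (conclusionsN π)                         ≡⟨ proj₁ wf x ⟩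
  1                                              ∎
  where open ≤-Reasoning

-- The cut table of a ¬e-normal net lists, for each (erasing) cut, the pair
-- (k , p) of its ?-side premise k, conclusion of a premise-less ?-link, and its
-- !-side premise p, main conclusion of a !-link.  Its keys, the cut leaves, are
-- as many as the cuts and pairwise distinct.

module CutTable (π : Net) where

  Edge : Set
  Edge = Fin (nE π)

  cutEntry : (L : Link (nE π)) → IsErasing π L → List (Edge × Edge)
  cutEntry (cut p₁ p₂) (inj₁ _) = [ (p₂ , p₁) ]
  cutEntry (cut p₁ p₂) (inj₂ _) = [ (p₁ , p₂) ]
  cutEntry _           _        = []

  cutTable : ∀ ls → All (IsErasing π) ls → List (Edge × Edge)
  cutTable []       []         = []
  cutTable (L ∷ ls) (ie ∷ ies) = cutEntry L ie ++ cutTable ls ies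

  length-cutTable : ∀ ls ies → length (keys (cutTable ls ies)) ≡ cutsL ls
  length-cutTable []                  []              = refl
  length-cutTable (cut _ _ ∷ ls)      (inj₁ _ ∷ ies)  = cong suc (length-cutTable ls ies)
  length-cutTable (cut _ _ ∷ ls)      (inj₂ _ ∷ ies)  = cong suc (length-cutTable ls ies)
  length-cutTable (ax _ _ ∷ ls)       (_ ∷ ies)       = length-cutTable ls ies
  length-cutTable (tensor _ _ _ ∷ ls) (_ ∷ ies)       = length-cutTable ls ies
  length-cutTable (par _ _ _ ∷ ls)    (_ ∷ ies)       = length-cutTable ls ies
  length-cutTable (one _ ∷ ls)        (_ ∷ ies)       = length-cutTable ls ies
  length-cutTable (bot _ ∷ ls)        (_ ∷ ies)       = length-cutTable ls ies
  length-cutTable (flat _ _ ∷ ls)     (_ ∷ ies)       = length-cutTable ls ies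
  length-cutTable (why _ _ ∷ ls)      (_ ∷ ies)       = length-cutTable ls ies

  occ-cutEntry : ∀ x L ie → occ x (keys (cutEntry L ie)) ≤ occ x (premisesL L)
  occ-cutEntry x (cut p₁ p₂) (inj₁ _)
    rewrite occ-∷ x p₁ (p₂ ∷ []) = m≤n+m _ (δ x p₁)
  occ-cutEntry x (cut p₁ p₂) (inj₂ _)
    rewrite occ-∷ x p₁ (p₂ ∷ []) | occ-∷ x p₁ [] = +-monoʳ-≤ (δ x p₁) z≤n
  occ-cutEntry x (ax _ _)       _ = z≤n
  occ-cutEntry x (tensor _ _ _) _ = z≤n
  occ-cutEntry x (par _ _ _)    _ = z≤n
  occ-cutEntry x (one _)        _ = z≤n
  occ-cutEntry x (bot _)        _ = z≤n
  occ-cutEntry x (flat _ _)     _ = z≤n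
  occ-cutEntry x (why _ _)      _ = z≤n

  occ-cutTable : ∀ x ls ies → occ x (keys (cutTable ls ies)) ≤ occ x (concatMap premisesL ls)
  occ-cutTable x []       []         = z≤n
  occ-cutTable x (L ∷ ls) (ie ∷ ies)
    rewrite map-++ proj₁ (cutEntry L ie) (cutTable ls ies)
          | occ-++ x (keys (cutEntry L ie)) (keys (cutTable ls ies))
          | occ-++ x (premisesL L) (concatMap premisesL ls) =
    +-mono-≤ (occ-cutEntry x L ie) (occ-cutTable x ls ies)

  CutPair : List (Link (nE π)) → Edge → Edge → Set
  CutPair ls k p = (cut p k ∈ ls ⊎ cut k p ∈ ls) × Any (λ b → concl b ≡ p) (bangs π) × why [] k ∈ links π

  ∈-cutTable⁻ : ∀ ls ies {k p} → (k , p) ∈ cutTable ls ies → CutPair ls k p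
  ∈-cutTable⁻ (L ∷ ls) (ie ∷ ies) m with ∈-++⁻ (cutEntry L ie) m
  ... | inj₂ m′ = let (c , rest) = ∈-cutTable⁻ ls ies m′ in ⊎-map there there c , rest
  ∈-cutTable⁻ (cut p₁ p₂ ∷ ls) (inj₁ (b , w) ∷ ies) m | inj₁ (here refl) = inj₁ (here refl) , b , w
  ∈-cutTable⁻ (cut p₁ p₂ ∷ ls) (inj₂ (b , w) ∷ ies) m | inj₁ (here refl) = inj₂ (here refl) , b , w

  ∈-cutTable⁺ : ∀ ls ies {p₁ p₂} → cut p₁ p₂ ∈ ls
              → ((p₂ , p₁) ∈ cutTable ls ies × Any (λ b → concl b ≡ p₁) (bangs π))
              ⊎ ((p₁ , p₂) ∈ cutTable ls ies × Any (λ b → concl b ≡ p₂) (bangs π))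
  ∈-cutTable⁺ (L ∷ ls) (inj₁ (b , _) ∷ ies) (here refl) = inj₁ (here refl , b)
  ∈-cutTable⁺ (L ∷ ls) (inj₂ (b , _) ∷ ies) (here refl) = inj₂ (here refl , b)
  ∈-cutTable⁺ (L ∷ ls) (ie ∷ ies) (there m) with ∈-cutTable⁺ ls ies m
  ... | inj₁ (m′ , b) = inj₁ (∈-++⁺ʳ (cutEntry L ie) m′ , b)
  ... | inj₂ (m′ , b) = inj₂ (∈-++⁺ʳ (cutEntry L ie) m′ , b)

module _ (π : Net) (wf : WF π) (ne : All (IsErasing π) (links π)) where
  open CutTable π

  cutLeaves : List (Fin (nE π))
  cutLeaves = keys (cutTable (links π) ne)

  -- a cut leaf is a premise, and edges are premises at most once
  cutLeaves-unique : ∀ x → occ x cutLeaves ≤ 1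
  cutLeaves-unique x = ≤-trans (occ-cutTable x (links π) ne) (proj₁ (proj₂ wf) x)

  cutLeaves⊆leaves : ∀ {k} → k ∈ cutLeaves → k ∈ leaves (links π)
  cutLeaves⊆leaves m with ∈-map⁻ proj₁ m
  ... | (k , p) , kp∈ , refl = ∈-leaves⁺ (links π) (proj₂ (proj₂ (∈-cutTable⁻ (links π) ne kp∈)))

-- In every experiment the main conclusion of a !-link carries a
-- non-empty positive bag, so the ?-side of an erasing cut carries a non-empty
-- negative one; hence every cut leaf contributes at least one element to 𝒲.

module _ {A : Set} where

  bang-shape : ∀ {n} {v : Fin n → D A} bs Es → BangsOK v bs Es
             → ∀ {p} → Any (λ b → concl b ≡ p) bs → Σ ℕ λ k → shape (v p) ≡ just (pos , suc k)
  bang-shape (b ∷ bs) ((h ∷ t) ∷ Es) (bok , _) (here refl) = _ , shape-≈ (proj₁ (proj₂ bok))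
  bang-shape (b ∷ bs) (E ∷ Es)       (_ , boks) (there a)  = bang-shape bs Es boks a

  nonempty-bag : ∀ (d : D A) {q k} → shape d ≡ just (q , suc k) → 1 ≤ length (bagOf d)
  nonempty-bag d e = subst (1 ≤_) (sym (proj₂ (shape-bag d e))) (s≤s z≤n)

  -- the ?-side of a cut holds the dual of the !-side, a non-empty bag
  cut-leaf-nonempty : (π : Net) (ne : All (IsErasing π) (links π)) (e : Exp A π) → IsExp e
                    → ∀ {k p} → (k , p) ∈ CutTable.cutTable π (links π) ne → 1 ≤ length (bagOf (val e k))
  cut-leaf-nonempty π ne e (linksOK , bangsOK) kp∈ with CutTable.∈-cutTable⁻ π (links π) ne kp∈
  ... | inj₁ cut-pk , b , _ =
    let (_ , sp) = bang-shape (bangs π) (boxes e) bangsOK b in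
    nonempty-bag (val e _) (Eq.trans (shape-≈ (All.lookup linksOK cut-pk))
                             (Eq.trans (shape-dual (val e _)) (cong flipShape sp)))
  ... | inj₂ cut-kp , b , _ =
    let (_ , sp) = bang-shape (bangs π) (boxes e) bangsOK b
        v = val e in
    nonempty-bag (v _) (Eq.trans (sym (flipShape-involutive (shape (v _))))
                         (cong flipShape (Eq.trans (sym (shape-dual (v _)))
                           (Eq.trans (sym (shape-≈ (All.lookup linksOK cut-kp))) sp))))

  occ-cutLeaves≤bag : (π : Net) (wf : WF π) (ne : All (IsErasing π) (links π)) (e : Exp A π) → IsExp e
                    → ∀ c → occ c (cutLeaves π wf ne) ≤ length (bagOf (val e c))
  occ-cutLeaves≤bag π wf ne e ok c with occ c (cutLeaves π wf ne) in eq
  ... | zero  = z≤n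
  ... | suc j with ∈-map⁻ proj₁ (occ⇒∈ (cutLeaves π wf ne) (subst (1 ≤_) (sym eq) (s≤s z≤n)))
  ...   | (.c , p) , cp∈ , refl =
          ≤-trans (subst (_≤ 1) eq (cutLeaves-unique π wf ne c)) (cut-leaf-nonempty π ne e ok cp∈)

  cuts≤W0 : (π : Net) → WF π → (ne : All (IsErasing π) (links π)) (e : Exp A π) → IsExp e
          → cutsL (links π) ≤ length (W0 (val e) (links π))
  cuts≤W0 π wf ne e ok = begin
    cutsL ls                                          ≡⟨ sym (CutTable.length-cutTable π ls ne) ⟩
    length C                                          ≤⟨ length≤Σocc C (leaves ls) (cutLeaves⊆leaves π wf ne) ⟩
    sumL (λ c → occ c C) (leaves ls)                  ≤⟨ sumL-mono _ _ (leaves ls) (λ c _ → occ≤bag c) ⟩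
    sumL (λ c → length (bagOf (val e c))) (leaves ls) ≡⟨ sym (W0-length (val e) ls) ⟩
    length (W0 (val e) ls)                            ∎
    where
    open ≤-Reasoning
    ls : List (Link (nE π))
    ls = links π
    C : List (Fin (nE π))
    C = cutLeaves π wf ne
    occ≤bag : ∀ c → occ c C ≤ length (bagOf (val e c))
    occ≤bag = occ-cutLeaves≤bag π wf ne e ok

  mutual
    cuts≤card-W : (π : Net) → WF π → NotENormal π → (e : Exp A π) → IsExp e → ncuts π ≤ card (W e)
    cuts≤card-W π wf ne e ok =
      subst (ncuts π ≤_) (sym (length-++ (W0 (val e) (links π))))
        (+-mono-≤ (cuts≤W0 π wf (proj₁ ne) e ok)
                  (cuts≤card-WBangs (bangs π) (boxes e) (proj₂ (proj₂ wf)) (proj₂ ne) (proj₂ ok)))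

    cuts≤card-WBangs : ∀ {n} (bs : List (Bang n)) (Es : All (λ b → List⁺ (Exp A (box b))) bs)
                     → WFBangs bs → NotENormalBangs bs → ∀ {v : Fin n → D A} → BangsOK v bs Es
                     → ncutsBangs bs ≤ length (WBangs bs Es)
    cuts≤card-WBangs []       []             _            _            _           = z≤n
    cuts≤card-WBangs (b ∷ bs) ((h ∷ t) ∷ Es) (wfb , wfbs) (neb , nebs) (bok , boks) =
      subst (ncuts (box b) + ncutsBangs bs ≤_) (sym (length-++ (WList (h ∷ t))))
        (+-mono-≤ (≤-trans (cuts≤card-W (box b) (proj₁ wfb) neb h (proj₁ (proj₁ bok)))
                           (subst (length (W h) ≤_) (sym (length-++ (W h))) (m≤m+n _ _)))
                  (cuts≤card-WBangs bs Es wfbs nebs boks))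

-- Upper bound.  sThin π is the size s of an experiment using one
-- sub-experiment per box, recursively; it is below s of every experiment.

mutual
  sThin : Net → ℕ
  sThin π = logicalEdges π + sThinBangs (bangs π)

  sThinBangs : ∀ {n} → List (Bang n) → ℕ
  sThinBangs []       = 0
  sThinBangs (b ∷ bs) = sThin (box b) + sThinBangs bs

-- a box with several experiments only adds to s
mutual
  sThin≤s : ∀ {A : Set} (π : Net) (e : Exp A π) → sThin π ≤ s e
  sThin≤s π e = +-monoʳ-≤ (logicalEdges π) (sThinBangs≤ (bangs π) (boxes e))

  sThinBangs≤ : ∀ {A : Set} {n} (bs : List (Bang n)) (Es : All (λ b → List⁺ (Exp A (box b))) bs)
              → sThinBangs bs ≤ sBangs bs Es
  sThinBangs≤ []       []             = z≤n
  sThinBangs≤ (b ∷ bs) ((h ∷ t) ∷ Es) = +-mono-≤ (≤-trans (sThin≤s (box b) h) (m≤m+n _ _)) (sThinBangs≤ bs Es)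

record Thin {A : Set} {n : ℕ} (b : Bang n) (E : List⁺ (Exp A (box b))) : Set where
  field
    ex    : Exp A (box b)
    exOK  : IsExp ex
    below : ∀ y → val ex y ≼ val (head⁺ E) y
    s≤    : s ex ≤ sThin (box b)
    W≤    : card (W ex) ≤ ncuts (box b)

data AllThin {A : Set} {n : ℕ} : (bs : List (Bang n)) → All (λ b → List⁺ (Exp A (box b))) bs → Set where
  []  : AllThin [] []
  _∷_ : ∀ {b bs E Es} → Thin b E → AllThin bs Es → AllThin (b ∷ bs) (E ∷ Es)

module Thinning {A : Set} (π : Net) (wf : WF π) (ne : All (IsErasing π) (links π))
                (e₀ : Exp A π) (ok₀ : IsExp e₀) (ts : AllThin (bangs π) (boxes e₀)) where

  open CutTable π

  n : ℕ
  n = nE π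

  ls : List (Link n)
  ls = links π

  v₀ : Fin n → D A
  v₀ = val e₀

  okL : ∀ {L} → L ∈ ls → LinkOK v₀ L
  okL = All.lookup (proj₁ ok₀)

  -- Every edge is produced either by a link, or by a !-link whose value is
  -- now given by its thin sub-experiment; sourceTable records which.
  data Source : Set where
    link  : Link n → Source
    given : D A → Source

  linkEntries : List (Link n) → List (Fin n × Source)
  linkEntries []       = []
  linkEntries (L ∷ ls) = map (λ c → c , link L) (conclusionsL L) ++ linkEntries ls

  auxEntry : (b : Bang n) → Exp A (box b) → Fin (nE (box b)) × Fin n → Fin n × Source
  auxEntry b ex (y , z) = z , given (bag neg (bagOf (val ex y)))

  bangEntries : (b : Bang n) → Exp A (box b) → List (Fin n × Source)
  bangEntries b ex = (concl b , given (bag pos [ val ex (main b) ])) ∷ map (auxEntry b ex) (aux b)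

  thinEntries : ∀ {bs : List (Bang n)} {Es} → AllThin {A} bs Es → List (Fin n × Source)
  thinEntries []              = []
  thinEntries (_∷_ {b} t ts) = bangEntries b (Thin.ex t) ++ thinEntries ts

  sourceTable : List (Fin n × Source)
  sourceTable = linkEntries ls ++ thinEntries ts

  source : Fin n → Maybe Source
  source x = lookupT x sourceTable

  keys-sourceTable : keys sourceTable ≡ conclusionsN π
  keys-sourceTable = Eq.trans (map-++ proj₁ (linkEntries ls) (thinEntries ts))
                       (cong₂ _++_ (keys-linkEntries ls) (keys-thinEntries ts))
    where
    keys-linkEntries : ∀ ls′ → keys (linkEntries ls′) ≡ concatMap conclusionsL ls′
    keys-linkEntries []        = refl
    keys-linkEntries (L ∷ ls′) = Eq.trans (map-++ proj₁ (map (λ c → c , link L) (conclusionsL L)) (linkEntries ls′))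
      (cong₂ _++_ (Eq.trans (sym (map-∘ (conclusionsL L))) (map-id (conclusionsL L)))
                  (keys-linkEntries ls′))
    keys-thinEntries : ∀ {bs′ : List (Bang n)} {Es} (ts′ : AllThin {A} bs′ Es)
                     → keys (thinEntries ts′) ≡ concatMap conclusionsB bs′
    keys-thinEntries []              = refl
    keys-thinEntries (_∷_ {b} t ts′) = Eq.trans (map-++ proj₁ (bangEntries b (Thin.ex t)) (thinEntries ts′))
      (cong₂ _++_ (cong (concl b ∷_) (sym (map-∘ (aux b)))) (keys-thinEntries ts′))

  source-unique : ∀ x → occ x (keys sourceTable) ≤ 1
  source-unique x = ≤-reflexive (Eq.trans (cong (occ x) keys-sourceTable) (proj₁ wf x))

  linkEntries-link : ∀ ls′ {x s} → (x , s) ∈ linkEntries ls′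
                   → Σ (Link n) λ L → (s ≡ link L) × (L ∈ ls′) × (x ∈ conclusionsL L)
  linkEntries-link (L ∷ ls′) m with ∈-++⁻ (map (λ c → c , link L) (conclusionsL L)) m
  ... | inj₂ m′ = let (L′ , eq , L∈ , x∈) = linkEntries-link ls′ m′ in L′ , eq , there L∈ , x∈
  ... | inj₁ m′ with ∈-map⁻ (λ c → c , link L) m′
  ...   | c , c∈ , refl = L , refl , here refl , c∈

  linkEntries⁺ : ∀ ls′ {x L} → L ∈ ls′ → x ∈ conclusionsL L → (x , link L) ∈ linkEntries ls′
  linkEntries⁺ (L ∷ ls′) (here refl) x∈ = ∈-++⁺ˡ (∈-map⁺ (λ c → c , link L) x∈)
  linkEntries⁺ (L ∷ ls′) (there m)   x∈ = ∈-++⁺ʳ (map (λ c → c , link L) (conclusionsL L)) (linkEntries⁺ ls′ m x∈)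

  thinEntries-given : ∀ {bs′ : List (Bang n)} {Es} (ts′ : AllThin {A} bs′ Es) {x s}
                    → (x , s) ∈ thinEntries ts′ → Σ (D A) λ d → s ≡ given d
  thinEntries-given (_∷_ {b} t ts′) m with ∈-++⁻ (bangEntries b (Thin.ex t)) m
  ... | inj₂ m′           = thinEntries-given ts′ m′
  ... | inj₁ (here refl)  = _ , refl
  ... | inj₁ (there m′) with ∈-map⁻ (auxEntry b (Thin.ex t)) m′
  ...   | _ , _ , refl = _ , refl

  source-link : ∀ {x L} → source x ≡ just (link L) → (L ∈ ls) × (x ∈ conclusionsL L)
  source-link e with ∈-++⁻ (linkEntries ls) (lookupT-sound sourceTable e)
  ... | inj₁ m with linkEntries-link ls m
  ...   | _ , refl , L∈ , x∈ = L∈ , x∈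
  source-link e | inj₂ m with thinEntries-given ts m
  ...   | _ , ()

  link-source : ∀ {x L} → L ∈ ls → x ∈ conclusionsL L → source x ≡ just (link L)
  link-source {x} L∈ x∈ = lookupT-∈ (∈-++⁺ˡ (linkEntries⁺ ls L∈ x∈)) (source-unique x)

  source-given : ∀ {x d} → source x ≡ just (given d) → (x , given d) ∈ thinEntries ts
  source-given e with ∈-++⁻ (linkEntries ls) (lookupT-sound sourceTable e)
  ... | inj₂ m = m
  ... | inj₁ m with linkEntries-link ls m
  ...   | _ , () , _

  given-source : ∀ {x s} → (x , s) ∈ thinEntries ts → source x ≡ just s
  given-source {x} m = lookupT-∈ (∈-++⁺ʳ (linkEntries ls) m) (source-unique x)

  concl-given : ∀ {bs′ : List (Bang n)} {Es} (ts′ : AllThin {A} bs′ Es) {p} → Any (λ b → concl b ≡ p) bs′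
              → Σ (List (D A)) λ l → (p , given (bag pos l)) ∈ thinEntries ts′
  concl-given (t ∷ ts′) (here refl) = _ , here refl
  concl-given (_∷_ {b} t ts′) (there a) =
    let (l , m) = concl-given ts′ a in l , ∈-++⁺ʳ (bangEntries b (Thin.ex t)) m

  -- Given values are ≼ the old ones, and a given positive bag is (at most) a
  -- singleton, since each box now has a single experiment.
  AtMostSingleton : D A → Set
  AtMostSingleton d = ∀ l → d ≡ bag pos l → length l ≤ 1

  given-below : ∀ {bs′ : List (Bang n)} {Es} (ts′ : AllThin {A} bs′ Es) → BangsOK v₀ bs′ Es
              → ∀ {x d} → (x , given d) ∈ thinEntries ts′ → (d ≼ v₀ x) × AtMostSingleton d
  given-below (_∷_ {b} {E = h ∷ t} th ts′) (bok , boks) m with ∈-++⁻ (bangEntries b (Thin.ex th)) m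
  ... | inj₂ m′ = given-below ts′ boks m′
  ... | inj₁ (here refl) =
        ≼-respʳ {x = bag pos [ val (Thin.ex th) (main b) ]} {y = bag pos (map (λ eᵢ → val eᵢ (main b)) (h ∷ t))}
                (sym (shape-≈ (proj₁ (proj₂ bok))))
          (1 , refl , s≤s z≤n)
      , λ { l refl → s≤s z≤n }
  ... | inj₁ (there m′) with ∈-map⁻ (auxEntry b (Thin.ex th)) m′
  ...   | (y , z) , yz∈ , refl with All.lookup (proj₂ (proj₂ bok)) yz∈
  ...     | (μ₁ ∷ μs) , (μ₁-ok ∷ _) , z-ok =
          ≼-respʳ {x = bag neg (bagOf (val (Thin.ex th) y))} {y = bag neg (concat (μ₁ ∷ μs))} (sym (shape-≈ z-ok))
            (length (bagOf (val (Thin.ex th) y)) , refl ,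
              ≤-trans (proj₂ (≼-bag (val (Thin.ex th) y) (val h y) (shape-≈ μ₁-ok) (Thin.below th y)))
                      (subst (length μ₁ ≤_) (sym (length-++ μ₁)) (m≤m+n (length μ₁) (length (concat μs)))))
        , λ { l () }

  source-given-below : ∀ {x d} → source x ≡ just (given d) → (d ≼ v₀ x) × AtMostSingleton d
  source-given-below e = given-below ts (proj₂ ok₀) (source-given e)

  -- A ?-link with premises adds up the bags of its
  -- premises; when exactly one premise p has a non-empty old bag, the
  -- conclusion has the same old value as p up to ≈, and up points to p.
  OldBag : Fin n → List (D A) → Set
  OldBag q μ = v₀ q ≈ bag neg μ

  filled : Fin n → Bool
  filled q = not (null (bagOf (v₀ q)))

  filledPremises : List (Fin n) → List (Fin n)
  filledPremises []       = []
  filledPremises (q ∷ qs) = if filled q then q ∷ filledPremises qs else filledPremises qs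

  theOnly : List (Fin n) → Maybe (Fin n)
  theOnly (p ∷ []) = just p
  theOnly _        = nothing

  theOnly-just : ∀ l {p} → theOnly l ≡ just p → l ≡ p ∷ []
  theOnly-just (a ∷ []) refl = refl
  theOnly-just []          ()
  theOnly-just (a ∷ b ∷ l) ()

  theOnly-nothing : ∀ l → theOnly l ≡ nothing → length l ≢ 1
  theOnly-nothing (a ∷ []) () _
  theOnly-nothing []          _ ()
  theOnly-nothing (a ∷ b ∷ l) _ ()

  upFrom : Maybe Source → Maybe (Fin n)
  upFrom (just (link (why ps _))) = theOnly (filledPremises ps)
  upFrom _                        = nothing

  up : Fin n → Maybe (Fin n)
  up x = upFrom (source x)

  open PointerChase up using (top; top-from)

  oldBag-length : ∀ q μ → OldBag q μ → length μ ≡ length (bagOf (v₀ q))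
  oldBag-length q μ old = sym (proj₂ (shape-bag (v₀ q) (shape-≈ old)))

  unfilled-empty : ∀ q μ → OldBag q μ → filled q ≡ false → μ ≡ []
  unfilled-empty q μ old e = length≡0⇒[] μ (Eq.trans (oldBag-length q μ old) (cong length (nonNull-false _ e)))

  filled-size : ∀ q μ → OldBag q μ → filled q ≡ true → 1 ≤ sizes μ
  filled-size q μ old e with μ | ≤-trans (nonNull-true _ e) (≤-reflexive (sym (oldBag-length q μ old)))
  ... | d ∷ μ′ | _ = ≤-trans (size-pos d) (m≤m+n (size d) (sizes μ′))

  none-filled : ∀ {ps μs} → Pointwise OldBag ps μs → filledPremises ps ≡ [] → concat μs ≡ []
  none-filled [] _ = refl
  none-filled {q ∷ ps} {μ ∷ μs} (old ∷ olds) e with filled q in eq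
  ... | false rewrite unfilled-empty q μ old eq = none-filled olds e

  only-filled : ∀ {ps μs p} → Pointwise OldBag ps μs → filledPremises ps ≡ p ∷ []
              → Σ (List (D A)) λ μ → OldBag p μ × (concat μs ≡ μ)
  only-filled {q ∷ ps} {μ ∷ μs} (old ∷ olds) e with filled q in eq
  ... | false rewrite unfilled-empty q μ old eq = only-filled olds e
  ... | true with ∷-injective e
  ...   | refl , rest = μ , old , Eq.trans (cong (μ ++_) (none-filled olds rest)) (++-identityʳ μ)

  up-why : ∀ {x p} → up x ≡ just p
         → Σ (List (Fin n)) λ ps → Σ (Fin n) λ c → (source x ≡ just (link (why ps c))) × (filledPremises ps ≡ p ∷ [])
  up-why {x} e with source x
  ... | just (link (why ps c)) = ps , c , refl , theOnly-just (filledPremises ps) e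

  up-preserves : ∀ {x p} → up x ≡ just p
               → (size (v₀ p) ≡ size (v₀ x)) × (shape (v₀ p) ≡ shape (v₀ x)) × Σ (List (D A)) (λ μ → OldBag p μ × OldBag x μ)
  up-preserves {x} {p} e with up-why e
  ... | ps , c , src , only with source-link src
  ...   | L∈ , here refl with ps | okL L∈
  ...     | q ∷ qs | μs , olds , x-ok with only-filled olds only
  ...       | μ , p-ok , cat≡μ =
              let x-ok′ = subst (λ z → v₀ x ≈ bag neg z) cat≡μ x-ok in
              Eq.trans (size-≈ p-ok) (sym (size-≈ x-ok′)) , Eq.trans (shape-≈ p-ok) (sym (shape-≈ x-ok′)) , μ , p-ok , x-ok′
  up-preserves e | ps , c , src , only | L∈ , here refl | [] | _ with () ← only

  top-preserves : ∀ k x t → top k x ≡ just t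
                → (size (v₀ t) ≡ size (v₀ x)) × (shape (v₀ t) ≡ shape (v₀ x)) × (up t ≡ nothing)
  top-preserves (suc k) x t e with up x in eq
  top-preserves (suc k) x t refl | nothing = refl , refl , eq
  ... | just p with top-preserves k p t e | up-preserves eq
  ...   | size≡ , shape≡ , top-t | size≡′ , shape≡′ , _ = Eq.trans size≡ size≡′ , Eq.trans shape≡ shape≡′ , top-t

  -- The new value of a premise-less ?-link: the dual of the (now singleton)
  -- bag of the !-link it is cut against, or the empty bag if it is not cut.
  givenBag : Maybe Source → List (D A)
  givenBag (just (given (bag pos l))) = dualL l
  givenBag _                          = []

  partnerBag : Maybe (Fin n) → List (D A)
  partnerBag nothing  = []
  partnerBag (just p) = givenBag (source p)

  leafValue : Fin n → D A
  leafValue c = bag neg (partnerBag (lookupT c (cutTable ls ne)))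

  collect : (Fin n → D A) → List (Fin n) → List (D A)
  collect h []       = []
  collect h (q ∷ qs) = (if filled q then bagOf (h q) else []) ++ collect h qs

  -- Recomputation of values with fuel f: first climb to the top of the ?-chain,
  -- then evaluate the link producing it on recomputed premises.  Without a top
  -- (a cycle) or without fuel the old value is kept.
  mutual
    recompute : ℕ → Fin n → D A
    recompute zero    x = v₀ x
    recompute (suc f) x = fromTop f x (top n x)

    fromTop : ℕ → Fin n → Maybe (Fin n) → D A
    fromTop f x nothing  = v₀ x
    fromTop f x (just t) = fromSource f t (source t)

    fromSource : ℕ → Fin n → Maybe Source → D A
    fromSource f t nothing          = v₀ t
    fromSource f t (just (given d)) = d
    fromSource f t (just (link L))  = fromLink f t L

    fromLink : ℕ → Fin n → Link n → D A
    fromLink f t (ax _ _)         = v₀ t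
    fromLink f t (cut _ _)        = v₀ t
    fromLink f t (tensor a b _)   = pair pos (recompute f a) (recompute f b)
    fromLink f t (par a b _)      = pair neg (recompute f a) (recompute f b)
    fromLink f t (one _)          = v₀ t
    fromLink f t (bot _)          = v₀ t
    fromLink f t (flat a _)       = bag neg [ recompute f a ]
    fromLink f t (why [] _)       = leafValue t
    fromLink f t (why (p ∷ ps) _) = bag neg (collect (recompute f) (p ∷ ps))

  givenBag-length : ∀ p → length (givenBag (source p)) ≤ 1
  givenBag-length p with source p in e
  ... | just (given (bag pos l))     = subst (_≤ 1) (sym (length-dualL l)) (proj₂ (source-given-below e) l refl)
  ... | just (given (bag neg _))     = z≤n
  ... | just (given (atom _ _))      = z≤n
  ... | just (given (star _))        = z≤n
  ... | just (given (pair _ _ _))    = z≤n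
  ... | just (link _)                = z≤n
  ... | nothing                      = z≤n

  partnerBag-length : ∀ c → length (partnerBag (lookupT c (cutTable ls ne))) ≤ occ c (cutLeaves π wf ne)
  partnerBag-length c with lookupT c (cutTable ls ne) in e
  ... | nothing = z≤n
  ... | just p  = ≤-trans (givenBag-length p) (∈⇒occ (∈-map⁺ proj₁ (lookupT-sound (cutTable ls ne) e)))

  -- cut leaves had a non-empty bag before, so the new leaf value is ≼ the old one
  leafValue-below : ∀ c a → v₀ c ≈ bag neg a → leafValue c ≼ v₀ c
  leafValue-below c a c-ok =
    ≼-respʳ {x = leafValue c} {y = bag neg a} (sym (shape-≈ c-ok))
      (_ , refl , ≤-trans (partnerBag-length c)
                   (≤-trans (occ-cutLeaves≤bag π wf ne e₀ ok₀ c) (≤-reflexive (sym (oldBag-length c a c-ok)))))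

  collect-length : ∀ h → (∀ x → h x ≼ v₀ x) → ∀ {ps μs} → Pointwise OldBag ps μs
                 → length (collect h ps) ≤ length (concat μs)
  collect-length h below []                        = z≤n
  collect-length h below {q ∷ ps} {μ ∷ μs} (old ∷ olds) =
    subst₂ _≤_ (sym (length-++ (if filled q then bagOf (h q) else []))) (sym (length-++ μ))
      (+-mono-≤ (one-premise (filled q)) (collect-length h below olds))
    where
    one-premise : ∀ b → length (if b then bagOf (h q) else []) ≤ length μ
    one-premise false = z≤n
    one-premise true  = proj₂ (≼-bag (h q) (v₀ q) (shape-≈ old) (below q))

  module _ (f : ℕ) (ih : ∀ x → recompute f x ≼ v₀ x) where

    fromLink-below : ∀ t L → L ∈ ls → t ∈ conclusionsL L → fromLink f t L ≼ v₀ t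
    fromLink-below t (ax _ _)       L∈ t∈ = ≼-refl (v₀ t)
    fromLink-below t (cut _ _)      L∈ t∈ = ≼-refl (v₀ t)
    fromLink-below t (one _)        L∈ t∈ = ≼-refl (v₀ t)
    fromLink-below t (bot _)        L∈ t∈ = ≼-refl (v₀ t)
    fromLink-below t (tensor a b c) L∈ (here refl) =
      ≼-respʳ {x = pair pos (recompute f a) (recompute f b)} {y = pair pos (v₀ a) (v₀ b)} (sym (shape-≈ (okL L∈))) tt
    fromLink-below t (par a b c)    L∈ (here refl) =
      ≼-respʳ {x = pair neg (recompute f a) (recompute f b)} {y = pair neg (v₀ a) (v₀ b)} (sym (shape-≈ (okL L∈))) tt
    fromLink-below t (flat a c)     L∈ (here refl) =
      ≼-respʳ {x = bag neg [ recompute f a ]} {y = bag neg [ v₀ a ]} (sym (shape-≈ (okL L∈))) (1 , refl , ≤-refl)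
    fromLink-below t (why [] c)     L∈ (here refl) = let (a , c-ok) = okL L∈ in leafValue-below c a c-ok
    fromLink-below t (why (q ∷ qs) c) L∈ (here refl) with okL L∈
    ... | μs , olds , c-ok =
      ≼-respʳ {x = bag neg (collect (recompute f) (q ∷ qs))} {y = bag neg (concat μs)} (sym (shape-≈ c-ok))
        (_ , refl , collect-length (recompute f) ih olds)

    fromSource-below : ∀ t → fromSource f t (source t) ≼ v₀ t
    fromSource-below t with source t in e
    ... | nothing       = ≼-refl (v₀ t)
    ... | just (given d) = proj₁ (source-given-below e)
    ... | just (link L)  = let (L∈ , t∈) = source-link e in fromLink-below t L L∈ t∈

  recompute-below : ∀ f x → recompute f x ≼ v₀ x
  recompute-below zero    x = ≼-refl (v₀ x)
  recompute-below (suc f) x with top n x in eq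
  ... | nothing = ≼-refl (v₀ x)
  ... | just t  = ≼-respʳ {x = fromSource f t (source t)} {y = v₀ t} (proj₁ (proj₂ (top-preserves n x t eq)))
                    (fromSource-below f (recompute-below f) t)

  -- The only link whose premises are not strictly smaller than its conclusion
  -- is a ?-link with exactly one filled premise, and that case is absorbed by
  -- the climb to the top.
  filled-count : ∀ {ps μs} → Pointwise OldBag ps μs → length (filledPremises ps) ≤ sizes (concat μs)
  filled-count [] = z≤n
  filled-count {q ∷ ps} {μ ∷ μs} (old ∷ olds) with filled q in eq
  ... | false rewrite unfilled-empty q μ old eq = filled-count olds
  ... | true  rewrite sizes-++ μ (concat μs)    = +-mono-≤ (filled-size q μ old eq) (filled-count olds)

  filled-size-bound : ∀ {ps μs q} → Pointwise OldBag ps μs → q ∈ filledPremises ps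
                    → size (v₀ q) + length (filledPremises ps) ≤ 2 + sizes (concat μs)
  filled-size-bound {q′ ∷ ps} {μ ∷ μs} (old ∷ olds) q∈ with filled q′ in eq
  ... | false rewrite unfilled-empty q′ μ old eq = filled-size-bound olds q∈
  ... | true rewrite sizes-++ μ (concat μs) with q∈
  ...   | here refl rewrite size-≈ old | +-suc (sizes μ) (length (filledPremises ps)) =
          s≤s (s≤s (+-monoʳ-≤ (sizes μ) (filled-count olds)))
  ...   | there m =
          ≤-trans (≤-reflexive (+-suc _ (length (filledPremises ps))))
            (≤-trans (s≤s (filled-size-bound olds m))
              (+-monoʳ-≤ 2 (+-monoˡ-≤ (sizes (concat μs)) (filled-size q′ μ old eq))))

  small-premise : ∀ {ps μs q} → Pointwise OldBag ps μs → length (filledPremises ps) ≢ 1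
                → q ∈ filledPremises ps → size (v₀ q) ≤ sizes (concat μs)
  small-premise {ps} {μs} {q} olds ≢1 q∈ =
    +-cancelʳ-≤ 2 (size (v₀ q)) (sizes (concat μs))
      (≤-trans (+-monoʳ-≤ (size (v₀ q)) (two-filled (filledPremises ps) q∈ ≢1))
        (≤-trans (filled-size-bound olds q∈) (≤-reflexive (+-comm 2 (sizes (concat μs))))))
    where
    two-filled : ∀ (l : List (Fin n)) → q ∈ l → length l ≢ 1 → 2 ≤ length l
    two-filled (a ∷ [])    _ ≢1 = ⊥-elim (≢1 refl)
    two-filled (a ∷ b ∷ l) _ _  = s≤s (s≤s z≤n)

  collect-cong : ∀ (h₁ h₂ : Fin n → D A) ps → (∀ {q} → q ∈ filledPremises ps → h₁ q ≡ h₂ q)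
               → collect h₁ ps ≡ collect h₂ ps
  collect-cong h₁ h₂ []       _  = refl
  collect-cong h₁ h₂ (q ∷ ps) eq with filled q
  ... | true  = cong₂ _++_ (cong bagOf (eq (here refl))) (collect-cong h₁ h₂ ps (λ m → eq (there m)))
  ... | false = collect-cong h₁ h₂ ps eq

  module _ (m f g : ℕ) (ih : ∀ y → size (v₀ y) ≤ m → recompute f y ≡ recompute g y) where

    smaller : ∀ {t a} {d : D A} → v₀ t ≈ d → size (v₀ t) ≤ suc m → size (v₀ a) ≤ pred (size d) → size (v₀ a) ≤ m
    smaller t-ok t≤ a≤ = ≤-trans a≤ (pred-mono-≤ (subst (_≤ suc m) (size-≈ t-ok) t≤))

    fromLink-stable : ∀ t L → L ∈ ls → t ∈ conclusionsL L → size (v₀ t) ≤ suc m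
                    → upFrom (just (link L)) ≡ nothing → fromLink f t L ≡ fromLink g t L
    fromLink-stable t (ax _ _)       L∈ t∈ t≤ top-t = refl
    fromLink-stable t (cut _ _)      L∈ t∈ t≤ top-t = refl
    fromLink-stable t (one _)        L∈ t∈ t≤ top-t = refl
    fromLink-stable t (bot _)        L∈ t∈ t≤ top-t = refl
    fromLink-stable t (tensor a b c) L∈ (here refl) t≤ top-t =
      cong₂ (pair pos) (ih a (smaller (okL L∈) t≤ (m≤m+n _ _))) (ih b (smaller (okL L∈) t≤ (m≤n+m _ _)))
    fromLink-stable t (par a b c)    L∈ (here refl) t≤ top-t =
      cong₂ (pair neg) (ih a (smaller (okL L∈) t≤ (m≤m+n _ _))) (ih b (smaller (okL L∈) t≤ (m≤n+m _ _)))
    fromLink-stable t (flat a c)     L∈ (here refl) t≤ top-t =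
      cong (λ z → bag neg [ z ]) (ih a (smaller (okL L∈) t≤ (m≤m+n _ _)))
    fromLink-stable t (why [] c)     L∈ (here refl) t≤ top-t = refl
    fromLink-stable t (why (q ∷ qs) c) L∈ (here refl) t≤ top-t with okL L∈
    ... | μs , olds , c-ok =
      cong (bag neg) (collect-cong (recompute f) (recompute g) (q ∷ qs)
        (λ q∈ → ih _ (smaller c-ok t≤ (small-premise olds (theOnly-nothing _ top-t) q∈))))

    fromSource-stable : ∀ t → size (v₀ t) ≤ suc m → upFrom (source t) ≡ nothing
                      → fromSource f t (source t) ≡ fromSource g t (source t)
    fromSource-stable t t≤ top-t with source t in e
    ... | nothing        = refl
    ... | just (given d) = refl
    ... | just (link L)  = let (L∈ , t∈) = source-link e in fromLink-stable t L L∈ t∈ t≤ top-t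

  recompute-stable : ∀ m x → size (v₀ x) ≤ m → ∀ f g → m ≤ f → m ≤ g → recompute f x ≡ recompute g x
  recompute-stable zero    x x≤ f g _ _ = ⊥-elim (1+n≰n (≤-trans (size-pos (v₀ x)) x≤))
  recompute-stable (suc m) x x≤ (suc f) (suc g) (s≤s m≤f) (s≤s m≤g) with top n x in eq
  ... | nothing = refl
  ... | just t  =
    let (size≡ , _ , top-t) = top-preserves n x t eq in
    fromSource-stable m f g (λ y y≤ → recompute-stable m y y≤ f g m≤f m≤g) t (subst (_≤ suc m) (sym size≡) x≤) top-t

  v′ : Fin n → D A
  v′ x = recompute (size (v₀ x)) x

  v′-unfold : ∀ x → v′ x ≡ fromTop (pred (size (v₀ x))) x (top n x)
  v′-unfold x = subst (λ S → recompute S x ≡ fromTop (pred S) x (top n x)) (size-suc (v₀ x)) refl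

  recompute≡v′ : ∀ y k → size (v₀ y) ≤ k → recompute k y ≡ v′ y
  recompute≡v′ y k y≤k = recompute-stable (size (v₀ y)) y ≤-refl k (size (v₀ y)) y≤k ≤-refl

  v′-below : ∀ x → v′ x ≼ v₀ x
  v′-below x = recompute-below (size (v₀ x)) x

  v′-top : ∀ x → up x ≡ nothing → v′ x ≡ fromSource (pred (size (v₀ x))) x (source x)
  v′-top x e = Eq.trans (v′-unfold x) (cong (fromTop _ x) (top-here up x e))

  v′-given : ∀ {x d} → source x ≡ just (given d) → v′ x ≡ d
  v′-given {x} e = Eq.trans (v′-top x (cong upFrom e)) (cong (fromSource _ x) e)

  v′-link : ∀ {x L} → L ∈ ls → x ∈ conclusionsL L → upFrom (just (link L)) ≡ nothing
          → v′ x ≡ fromLink (pred (size (v₀ x))) x L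
  v′-link {x} L∈ x∈ top-x = let e = link-source L∈ x∈ in
    Eq.trans (v′-top x (Eq.trans (cong upFrom e) top-x)) (cong (fromSource _ x) e)

  recompute-premise : ∀ {c a} {d : D A} → v₀ c ≈ d → size (v₀ a) ≤ pred (size d)
                    → recompute (pred (size (v₀ c))) a ≡ v′ a
  recompute-premise {c} {a} c-ok a≤ = recompute≡v′ a _ (subst (size (v₀ a) ≤_) (sym (cong pred (size-≈ c-ok))) a≤)

  leafValue-partner : ∀ {c p l} → lookupT c (cutTable ls ne) ≡ just p → source p ≡ just (given (bag pos l))
                    → leafValue c ≡ bag neg (dualL l)
  leafValue-partner e₁ e₂ rewrite e₁ | e₂ = refl

  cut-ok : ∀ {p₁ p₂} → cut p₁ p₂ ∈ ls → v′ p₂ ≈ dual (v′ p₁)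
  cut-ok {p₁} {p₂} L∈ with ∈-cutTable⁺ ls ne L∈
  ... | inj₁ (m , b) =
    let (l , g) = concl-given ts b
        src     = given-source g
        partner = lookupT-∈ m (cutLeaves-unique π wf ne p₂)
        leaf    = proj₂ (proj₂ (∈-cutTable⁻ ls ne m)) in
    ≡⇒≈ (Eq.trans (v′-link leaf (here refl) refl)
          (Eq.trans (leafValue-partner partner src) (cong dual (sym (v′-given src)))))
  ... | inj₂ (m , b) =
    let (l , g) = concl-given ts b
        src     = given-source g
        partner = lookupT-∈ m (cutLeaves-unique π wf ne p₁)
        leaf    = proj₂ (proj₂ (∈-cutTable⁻ ls ne m)) in
    ≡⇒≈ (Eq.trans (v′-given src)
          (Eq.trans (cong (bag pos) (sym (dualL-dualL l)))
            (cong dual (sym (Eq.trans (v′-link leaf (here refl) refl) (leafValue-partner partner src))))))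

  NewBag : Fin n → List (D A) → Set
  NewBag q μ = v′ q ≈ bag neg μ

  new-bag : ∀ q μ → OldBag q μ → v′ q ≡ bag neg (bagOf (v′ q))
  new-bag q μ old = proj₁ (≼-bag (v′ q) (v₀ q) (shape-≈ old) (v′-below q))

  new-unfilled : ∀ q μ → OldBag q μ → filled q ≡ false → NewBag q []
  new-unfilled q μ old e =
    let le = proj₂ (≼-bag (v′ q) (v₀ q) (shape-≈ old) (v′-below q))
        empty = length≡0⇒[] (bagOf (v′ q))
                  (n≤0⇒n≡0 (subst (λ z → length (bagOf (v′ q)) ≤ length z) (unfilled-empty q μ old e) le)) in
    ≡⇒≈ (Eq.trans (new-bag q μ old) (cong (bag neg) empty))

  collect-none : ∀ h ps → filledPremises ps ≡ [] → collect h ps ≡ []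
  collect-none h []       _ = refl
  collect-none h (q ∷ ps) e with filled q
  ... | false = collect-none h ps e

  new-bags : ∀ {ps μs} → Pointwise OldBag ps μs
           → Σ (List (List (D A))) λ μs′ → Pointwise NewBag ps μs′ × (collect v′ ps ≡ concat μs′)
  new-bags [] = [] , [] , refl
  new-bags {q ∷ ps} {μ ∷ μs} (old ∷ olds) with new-bags olds | filled q in e
  ... | μs′ , news , cat | true  = bagOf (v′ q) ∷ μs′ , ≡⇒≈ (new-bag q μ old) ∷ news , cong (bagOf (v′ q) ++_) cat
  ... | μs′ , news , cat | false = [] ∷ μs′ , new-unfilled q μ old e ∷ news , cat

  only-bag : ∀ {ps μs p M} → Pointwise OldBag ps μs → filledPremises ps ≡ p ∷ [] → NewBag p M
           → Σ (List (List (D A))) λ μs′ → Pointwise NewBag ps μs′ × (concat μs′ ≡ M)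
  only-bag {q ∷ ps} {μ ∷ μs} {M = M} (old ∷ olds) e p-new with filled q in eq
  ... | false = let (μs′ , news , cat) = only-bag olds e p-new in [] ∷ μs′ , new-unfilled q μ old eq ∷ news , cat
  ... | true with ∷-injective e
  ...   | refl , rest =
          let (μs′ , news , cat) = new-bags olds in
          M ∷ μs′ , p-new ∷ news , Eq.trans (cong (M ++_) (Eq.trans (sym cat) (collect-none v′ ps rest))) (++-identityʳ M)

  -- along a chain step c → p the new values share their bag: both come from
  -- the common top, or both keep their old values on a cycle
  chain-step : ∀ {c p} → up c ≡ just p → Σ (List (D A)) λ M → NewBag p M × NewBag c M
  chain-step {c} {p} up-c with up-preserves up-c | top-successor up c p up-c
  ... | size≡ , _ , μ , p-old , c-old | top≡ with top n c in eq
  ...   | nothing =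
          let c-same = Eq.trans (v′-unfold c) (cong (fromTop _ c) eq)
              p-same = Eq.trans (v′-unfold p) (cong (fromTop _ p) top≡) in
          μ , ≡-≈-trans p-same p-old , ≡-≈-trans c-same c-old
  ...   | just t =
          let c-top  = Eq.trans (v′-unfold c) (cong (fromTop _ c) eq)
              p-top  = Eq.trans (v′-unfold p) (Eq.trans (cong (fromTop _ p) top≡)
                         (cong (λ k → fromSource k t (source t)) (cong pred size≡)))
              p≡c    = Eq.trans p-top (sym c-top) in
          bagOf (v′ p) , ≡⇒≈ (new-bag p μ p-old) , ≡⇒≈ (Eq.trans (sym p≡c) (new-bag p μ p-old))

  why-ok : ∀ {q qs c} → why (q ∷ qs) c ∈ ls → LinkOK v′ (why (q ∷ qs) c)
  why-ok {q} {qs} {c} L∈ with okL L∈ | theOnly (filledPremises (q ∷ qs)) in only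
  ... | μs , olds , c-ok | nothing =
        let (μs′ , news , cat) = new-bags olds
            stable = collect-cong _ v′ (q ∷ qs)
                       (λ q∈ → recompute-premise c-ok (small-premise olds (theOnly-nothing _ only) q∈)) in
        μs′ , news , ≡⇒≈ (Eq.trans (v′-link L∈ (here refl) only) (cong (bag neg) (Eq.trans stable cat)))
  ... | μs , olds , c-ok | just p =
        let (M , p-new , c-new) = chain-step (Eq.trans (cong upFrom (link-source L∈ (here refl))) only)
            (μs′ , news , cat)  = only-bag olds (theOnly-just _ only) p-new in
        μs′ , news , subst (λ z → v′ c ≈ bag neg z) (sym cat) c-new

  link-ok : ∀ {L} → L ∈ ls → LinkOK v′ L
  link-ok {ax c₁ c₂} L∈ =
    subst₂ (λ a b → b ≈ dual a) (sym (v′-link L∈ (here refl) refl)) (sym (v′-link L∈ (there (here refl)) refl)) (okL L∈)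
  link-ok {cut p₁ p₂} L∈ = cut-ok L∈
  link-ok {tensor a b c} L∈ =
    ≡⇒≈ (Eq.trans (v′-link L∈ (here refl) refl)
          (cong₂ (pair pos) (recompute-premise (okL L∈) (m≤m+n _ _)) (recompute-premise (okL L∈) (m≤n+m _ (size (v₀ a))))))
  link-ok {par a b c} L∈ =
    ≡⇒≈ (Eq.trans (v′-link L∈ (here refl) refl)
          (cong₂ (pair neg) (recompute-premise (okL L∈) (m≤m+n _ _)) (recompute-premise (okL L∈) (m≤n+m _ (size (v₀ a))))))
  link-ok {one c} L∈ = ≡-≈-trans (v′-link L∈ (here refl) refl) (okL L∈)
  link-ok {bot c} L∈ = ≡-≈-trans (v′-link L∈ (here refl) refl) (okL L∈)
  link-ok {flat a c} L∈ =
    ≡⇒≈ (Eq.trans (v′-link L∈ (here refl) refl) (cong (λ z → bag neg [ z ]) (recompute-premise (okL L∈) (m≤m+n _ _))))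
  link-ok {why [] c} L∈ = _ , ≡⇒≈ (v′-link L∈ (here refl) refl)
  link-ok {why (q ∷ qs) c} L∈ = why-ok L∈

  thinBoxes : ∀ {bs : List (Bang n)} {Es} → AllThin {A} bs Es → All (λ b → List⁺ (Exp A (box b))) bs
  thinBoxes []       = []
  thinBoxes (t ∷ ts) = (Thin.ex t ∷ []) ∷ thinBoxes ts

  bangs-ok : ∀ {bs′ : List (Bang n)} {Es} (ts′ : AllThin {A} bs′ Es) → BangsOK v₀ bs′ Es
           → (∀ {e} → e ∈ thinEntries ts′ → e ∈ thinEntries ts) → BangsOK v′ bs′ (thinBoxes ts′)
  bangs-ok []                          _            _   = tt
  bangs-ok (_∷_ {b} {E = h ∷ _} t ts′) (bok , boks) inc =
      ((Thin.exOK t , tt) , ≡⇒≈ (v′-given (given-source (inc (here refl)))) , All.tabulate aux-ok)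
    , bangs-ok ts′ boks (λ m → inc (∈-++⁺ʳ (bangEntries b (Thin.ex t)) m))
    where
    ex = Thin.ex t
    aux-ok : ∀ {yz} → yz ∈ aux b
           → Σ (List (List (D A))) λ μs → Pointwise (λ eᵢ μ → val eᵢ (proj₁ yz) ≈ bag neg μ) (ex ∷ []) μs
                                         × v′ (proj₂ yz) ≈ bag neg (concat μs)
    aux-ok {y , z} yz∈ with All.lookup (proj₂ (proj₂ bok)) yz∈
    ... | (μ₁ ∷ _) , (μ₁-ok ∷ _) , _ =
      let M     = bagOf (val ex y)
          y-bag = proj₁ (≼-bag (val ex y) (val h y) (shape-≈ μ₁-ok) (Thin.below t y))
          z-val = v′-given (given-source (inc (∈-++⁺ˡ (there (∈-map⁺ (auxEntry b ex) yz∈))))) in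
      (M ∷ []) , (≡⇒≈ y-bag ∷ []) , ≡⇒≈ (Eq.trans z-val (cong (bag neg) (sym (++-identityʳ M))))

  e′ : Exp A π
  e′ = record { val = v′ ; boxes = thinBoxes ts }

  e′-ok : IsExp e′
  e′-ok = All.tabulate link-ok , bangs-ok ts (proj₂ ok₀) (λ m → m)

  e′-s≤ : s e′ ≤ sThin π
  e′-s≤ = +-monoʳ-≤ (logicalEdges π) (boxes-s≤ ts)
    where
    boxes-s≤ : ∀ {bs′ : List (Bang n)} {Es} (ts′ : AllThin {A} bs′ Es)
             → sBangs bs′ (thinBoxes ts′) ≤ sThinBangs bs′
    boxes-s≤ []        = z≤n
    boxes-s≤ (t ∷ ts′) = +-mono-≤ (≤-trans (≤-reflexive (+-identityʳ _)) (Thin.s≤ t)) (boxes-s≤ ts′)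

  -- 𝒲 at depth 0: only cut leaves carry a bag, of at most one element.
  W0-e′ : length (W0 v′ ls) ≤ cutsL ls
  W0-e′ = begin
    length (W0 v′ ls)                               ≡⟨ W0-length v′ ls ⟩
    sumL (λ c → length (bagOf (v′ c))) (leaves ls)  ≤⟨ sumL-mono _ _ (leaves ls) leaf-bound ⟩
    sumL (λ c → occ c C) (leaves ls)                ≤⟨ Σocc≤length C (leaves ls) (leaves-unique π wf) ⟩
    length C                                        ≡⟨ length-cutTable ls ne ⟩
    cutsL ls                                        ∎
    where
    open ≤-Reasoning
    C : List (Fin n)
    C = cutLeaves π wf ne
    leaf-bound : ∀ c → c ∈ leaves ls → length (bagOf (v′ c)) ≤ occ c C
    leaf-bound c m rewrite v′-link (∈-leaves⁻ ls m) (here refl) refl = partnerBag-length c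

  e′-W≤ : card (W e′) ≤ ncuts π
  e′-W≤ = subst (_≤ ncuts π) (sym (length-++ (W0 v′ ls))) (+-mono-≤ W0-e′ (boxes-W≤ ts))
    where
    boxes-W≤ : ∀ {bs′ : List (Bang n)} {Es} (ts′ : AllThin {A} bs′ Es)
             → length (WBangs bs′ (thinBoxes ts′)) ≤ ncutsBangs bs′
    boxes-W≤ []              = z≤n
    boxes-W≤ (_∷_ {b} t ts′) =
      subst (_≤ _) (sym (Eq.trans (length-++ (W (Thin.ex t) ++ []))
                                  (cong (_+ _) (cong length (++-identityʳ (W (Thin.ex t)))))))
        (+-mono-≤ (Thin.W≤ t) (boxes-W≤ ts′))

mutual
  thin : ∀ {A : Set} (π : Net) → WF π → NotENormal π → (e₀ : Exp A π) → IsExp e₀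
       → Σ (Exp A π) λ e → IsExp e × (∀ y → val e y ≼ val e₀ y) × (s e ≤ sThin π) × (card (W e) ≤ ncuts π)
  thin π wf ne e₀ ok₀ =
    let boxesThin = thinAll (bangs π) (boxes e₀) (proj₂ (proj₂ wf)) (proj₂ ne) (proj₂ ok₀)
        open Thinning π wf (proj₁ ne) e₀ ok₀ boxesThin in
    e′ , e′-ok , v′-below , e′-s≤ , e′-W≤

  thinAll : ∀ {A : Set} {n} (bs : List (Bang n)) (Es : All (λ b → List⁺ (Exp A (box b))) bs)
          → WFBangs bs → NotENormalBangs bs → ∀ {v : Fin n → D A} → BangsOK v bs Es → AllThin bs Es
  thinAll []       []             _            _            _            = []
  thinAll (b ∷ bs) ((h ∷ _) ∷ Es) (wfb , wfbs) (neb , nebs) (bok , boks) =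
    let (e , ok , below , s≤ , W≤) = thin (box b) (proj₁ wfb) neb h (proj₁ (proj₁ bok)) in
    record { ex = e ; exOK = ok ; below = below ; s≤ = s≤ ; W≤ = W≤ } ∷ thinAll bs Es wfbs nebs boks

lemma59 : {A : Set} (π : Net) → WF π → NotENormal π
        → (e₀ : Exp A π) → IsExp e₀
        → ((e : Exp A π) → IsExp e → s′ e₀ ≤ s′ e)
        → card (W e₀) ≡ ncuts π
lemma59 π wf ne e₀ ok₀ minimal with thin π wf ne e₀ ok₀
... | e , e-ok , _ , s-e≤ , W-e≤ = ≤-antisym W≤cuts (cuts≤card-W π wf ne e₀ ok₀)
  where
  squeeze : s e₀ + 2 * card (W e₀) ≤ s e₀ + 2 * ncuts π
  squeeze = begin
    s e₀ + 2 * card (W e₀) ≤⟨ minimal e e-ok ⟩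
    s e  + 2 * card (W e)  ≤⟨ +-mono-≤ (≤-trans s-e≤ (sThin≤s π e₀)) (*-monoʳ-≤ 2 W-e≤) ⟩
    s e₀ + 2 * ncuts π     ∎
    where open ≤-Reasoning
  W≤cuts : card (W e₀) ≤ ncuts π
  W≤cuts = *-cancelˡ-≤ 2 (+-cancelˡ-≤ (s e₀) _ _ squeeze)
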